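{- Let $S=\{w(1),\dots,w(n)\}$ be a multiset of positive weights of $n$ balls, and let $p$ be the number of (unordered) partitions $\{A,B\}$ of the set of balls $[n]$ into two parts with $w(A)=w(B)$. Suppose $p\neq 0$. Then (i) $M_2(S)\ge n-1-\mu(p)$, i.e., at least $n-1-\mu(p)$ queries are needed; (ii) if $p$ is even, then $M_2(S)\le n-2$, i.e., $n-2$ queries are enough.
   Context: Balls $1,\dots,n$ have positive weights $w(1),\dots,w(n)$, and each ball is colored with one of $2$ colors. For $T\subseteq[n]$, $w(T)=\sum_{i\in T}w(i)$, and $w=w([n])$. A color is a majority color if its color class $C$ satisfies $w(C)>w/2$. A query is a pair of balls and its answer tells whether they have the same color. $M_2(S)$ is the minimum, over adaptive strategies (each query may depend on previous answers), of the worst-case number of queries needed to determine whether a majority color exists and, if so, to exhibit a ball of that color. For a positive integer $m$, $\mu(m)$ denotes the largest integer $l$ such that $2^l$ divides $m$.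
   Formalization: The weights $w(1),\dots,w(n)$ of the balls are positive rationals. -}

module Defs where

open import Data.Nat as ℕ using (ℕ; zero; suc; _^_; _∸_; _/_)
open import Data.Nat.Divisibility using (_∣_)
open import Data.Fin using (Fin; zero; suc)
open import Data.Bool using (Bool; true; false; if_then_else_; not)
open import Data.List using (List; []; _∷_; _++_; map; filter; length)
open import Data.Maybe using (Maybe; just; nothing)
open import Data.Product using (_×_)
open import Data.Rational using (ℚ; 0ℚ; ½; _+_; _*_; _<_)
open import Data.Rational.Properties using (_≟_)
open import Relation.Binary.PropositionalEquality using (_≡_)

_≡ᵇ_ : Bool → Bool → Bool
true ≡ᵇ b = b
false ≡ᵇ b = not b

-- Weights of the n balls: w : Fin n → ℚ (required positive in the statement).
-- A 2-coloring of the balls: c : Fin n → Bool.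

sumFin : ∀ {n} → (Fin n → ℚ) → ℚ
sumFin {zero}  f = 0ℚ
sumFin {suc n} f = f zero + sumFin (λ i → f (suc i))

total : ∀ {n} → (Fin n → ℚ) → ℚ
total w = sumFin w

classWeight : ∀ {n} → (Fin n → ℚ) → (Fin n → Bool) → Bool → ℚ
classWeight w c b = sumFin (λ i → if c i ≡ᵇ b then w i else 0ℚ)

IsMajority : ∀ {n} → (Fin n → ℚ) → (Fin n → Bool) → Bool → Set
IsMajority w c b = total w * ½ < classWeight w c b

allColorings : ∀ n → List (Fin n → Bool)
allColorings zero    = (λ ()) ∷ []
allColorings (suc n) = go true ++ go false
  where
  go : Bool → List (Fin (suc n) → Bool)
  go b = map (λ c → λ { zero → b ; (suc i) → c i }) (allColorings n)

orderedEqualSplits : ∀ {n} → (Fin n → ℚ) → ℕ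
orderedEqualSplits {n} w =
  length (filter (λ c → classWeight w c true ≟ classWeight w c false) (allColorings n))

-- p = number of unordered partitions {A , B} of [n] with w(A) = w(B)
-- (each unordered partition is counted twice among ordered splits)
equalPartitions : ∀ {n} → (Fin n → ℚ) → ℕ
equalPartitions w = orderedEqualSplits w / 2

IsMu : ℕ → ℕ → Set
IsMu m l = (2 ^ l ∣ m) × (∀ k → 2 ^ k ∣ m → k ℕ.≤ l)

-- Adaptive query strategies (decision trees).
-- query i j s d : ask whether balls i and j have the same colour;
--                 continue with s if yes, with d if no.
-- noMajority     : answer "there is no majority colour".
-- majorityBall k : answer "ball k has the majority colour".
data Strategy (n : ℕ) : Set where
  noMajority   : Strategy n
  majorityBall : Fin n → Strategy n
  query        : Fin n → Fin n → Strategy n → Strategy n → Strategy n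

depth : ∀ {n} → Strategy n → ℕ
depth noMajority       = 0
depth (majorityBall k) = 0
depth (query i j s d)  = suc (depth s ℕ.⊔ depth d)

run : ∀ {n} → Strategy n → (Fin n → Bool) → Maybe (Fin n)
run noMajority       c = nothing
run (majorityBall k) c = just k
run (query i j s d)  c = if c i ≡ᵇ c j then run s c else run d c

CorrectAnswer : ∀ {n} → (Fin n → ℚ) → (Fin n → Bool) → Maybe (Fin n) → Set
CorrectAnswer w c nothing  = ∀ b → IsMajority w c b → Data.Empty.⊥
  where import Data.Empty
CorrectAnswer w c (just k) = IsMajority w c (c k)

Solves : ∀ {n} → (Fin n → ℚ) → Strategy n → Set
Solves {n} w t = (c : Fin n → Bool) → CorrectAnswer w c (run t c)

-- A correct strategy answers "no majority" exactly on the 2p balanced colourings. Along a branch,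
-- every answered query either merges two classes of balls whose relative colours are known, or is
-- already determined by the earlier answers, so the colourings reaching a leaf of depth d form a
-- coset of a subgroup of (ℤ/2)ⁿ of size at least 2^(n-d), or are empty; hence 2^(n-D) divides 2p
-- for a strategy of depth D, which is (i).
--
-- For (ii) keep a partition of the balls into classes of known relative colour such that the
-- number N of balanced colourings consistent with it is divisible by 4. For three classes let
-- Aᵢⱼ count those in which the representatives of classes i and j agree. Every colouring makes one
-- or three pairs agree, so A₁₂ + A₀₁ + A₀₂ = N + 2E; halving by complement symmetry, some Aᵢⱼ is
-- divisible by 4, and querying that pair keeps the invariant in both branches. After n - 2
-- queries two classes remain and the four consistent colourings form two complementary pairs, so
-- either all of them are balanced or none is; in the latter case a ball in the majority class of
-- two non-complementary ones is in the majority class of all four.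
module Submission where

open import Defs
open import Algebra.Bundles using (CommutativeMonoid)
import Algebra.Properties.CommutativeSemigroup as CommutativeSemigroupProperties
open import Data.Bool using (Bool; true; false; not; _∧_; _xor_; if_then_else_; T)
open import Data.Bool.Properties
  using (T-∧; T-≡; ¬-not; not-involutive; xor-assoc; xor-identityʳ; not-distribˡ-xor; ∧-zeroʳ;
         ∧-commutativeMonoid)
import Data.Bool.Properties as Bool
open import Data.Empty using (⊥; ⊥-elim)
open import Data.Fin using (Fin; zero; suc; punchIn; punchOut)
open import Data.Fin.Properties
  using (_≟_; any?; punchInᵢ≢i; punchOut-cong; punchOut-punchIn; punchIn-punchOut)
open import Data.List as List using (filter; length)
open import Data.List.Properties using (map-++; map-∘; map-cong)
open import Data.Maybe using (Maybe; just; nothing; is-nothing)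
open import Data.Nat using (ℕ; zero; suc; _+_; _*_; _∸_; _^_; _≤_; _/_; _%_; _⊔_; z≤n; s≤s)
open import Data.Nat.DivMod using (m*n/n≡m; m%n<n; %-distribˡ-+)
open import Data.Nat.Divisibility
  using (_∣_; _∣?_; _∣0; 1∣_; ∣-trans; ∣-reflexive; ∣1⇒≡1; *-monoʳ-∣; *-cancelˡ-∣; ∣n⇒∣m*n; m∣m*n;
         ∣m∣n⇒∣m+n; ∣m+n∣m⇒∣n; m*n∣o⇒m∣o/n; m%n≡0⇒n∣m)
open import Data.Nat.ListAction using (sum)
open import Data.Nat.ListAction.Properties using (sum-++)
open import Data.Nat.Properties
  using (+-comm; +-assoc; +-identityʳ; *-comm; *-assoc; *-zeroʳ; *-distribˡ-+; ⊔-lub; m≤m⊔n; m≤n⊔m;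
         m≤n⇒m≤1+n; ∸-monoʳ-≤; ∸-+-assoc; m≤n+m∸n; m≤n+o⇒m∸n≤o; +-monoʳ-≤; +-commutativeSemigroup;
         module ≤-Reasoning)
open import Data.Product using (∃; ∃-syntax; _×_; _,_; proj₁; proj₂)
open import Data.Rational using (ℚ; 0ℚ; ½; _<_; _<?_)
import Data.Rational as ℚ
import Data.Rational.Properties as ℚₚ
open import Data.Vec.Functional using (Vector; []; _∷_; map; tail; insertAt)
open import Data.Vec.Functional.Properties using (insertAt-lookup; insertAt-punchIn; insertAt-removeAt)
open import Function using (_∘_; id)
open import Function.Bundles using (Equivalence)
open import Relation.Binary using (tri<; tri≈; tri>)
open import Relation.Binary.PropositionalEquality
  using (_≡_; _≢_; _≗_; refl; sym; trans; cong; cong₂; subst; module ≡-Reasoning)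
open import Relation.Nullary using (¬_; Dec; does; yes; no; _×-dec_)
open import Relation.Unary using (Pred; Decidable)

open CommutativeSemigroupProperties +-commutativeSemigroup
  using () renaming (interchange to +-interchange)
open CommutativeSemigroupProperties (CommutativeMonoid.commutativeSemigroup ∧-commutativeMonoid)
  using () renaming (xy∙z≈xz∙y to ∧-swapʳ)

private variable n K : ℕ

T⇔T⇒≡ : ∀ {x y} → (T x → T y) → (T y → T x) → x ≡ y
T⇔T⇒≡ {true}  {true}  _ _ = refl
T⇔T⇒≡ {true}  {false} f _ = ⊥-elim (f _)
T⇔T⇒≡ {false} {true}  _ g = ⊥-elim (g _)
T⇔T⇒≡ {false} {false} _ _ = refl

does-sound : ∀ {A : Set} (a? : Dec A) → T (does a?) → A
does-sound (yes a) _ = a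

does-complete : ∀ {A : Set} (a? : Dec A) → A → T (does a?)
does-complete (yes _) _ = _
does-complete (no ¬a) a = ¬a a

≡ᵇ-sound : ∀ {x y} → T (x ≡ᵇ y) → x ≡ y
≡ᵇ-sound {true}  {true}  _ = refl
≡ᵇ-sound {false} {false} _ = refl

≡ᵇ-complete : ∀ {x y} → x ≡ y → T (x ≡ᵇ y)
≡ᵇ-complete {true}  refl = _
≡ᵇ-complete {false} refl = _

not-≡ᵇ-not : ∀ x y → (not x ≡ᵇ not y) ≡ (x ≡ᵇ y)
not-≡ᵇ-not true  true  = refl
not-≡ᵇ-not true  false = refl
not-≡ᵇ-not false true  = refl
not-≡ᵇ-not false false = refl

not-≡ᵇ : ∀ x y → (not x ≡ᵇ y) ≡ (x ≡ᵇ not y)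
not-≡ᵇ true  true  = refl
not-≡ᵇ true  false = refl
not-≡ᵇ false true  = refl
not-≡ᵇ false false = refl

xor-≡ᵇ-xor : ∀ x p q → ((x xor p) ≡ᵇ (x xor q)) ≡ (p ≡ᵇ q)
xor-≡ᵇ-xor true  p q = not-≡ᵇ-not p q
xor-≡ᵇ-xor false p q = refl

xor-shift : ∀ x b y → ((x xor b) ≡ᵇ y) ≡ (x ≡ᵇ (y xor b))
xor-shift true  true  true  = refl
xor-shift true  true  false = refl
xor-shift true  false true  = refl
xor-shift true  false false = refl
xor-shift false true  true  = refl
xor-shift false true  false = refl
xor-shift false false true  = refl
xor-shift false false false = refl

agree-shift : ∀ a x y → (a ≡ᵇ (x ≡ᵇ y)) ≡ (x ≡ᵇ (y xor not a))
agree-shift true  true  true  = refl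
agree-shift true  true  false = refl
agree-shift true  false true  = refl
agree-shift true  false false = refl
agree-shift false true  true  = refl
agree-shift false true  false = refl
agree-shift false false true  = refl
agree-shift false false false = refl

∧-congˡ-T : ∀ x {y z} → (T x → y ≡ z) → x ∧ y ≡ x ∧ z
∧-congˡ-T true  y≡z = y≡z _
∧-congˡ-T false y≡z = refl

-- Colourings and counting

Colouring : ℕ → Set
Colouring n = Vector Bool n

Extensional : {A : Set} → (Colouring n → A) → Set
Extensional f = ∀ {c d} → c ≗ d → f c ≡ f d

∷-tail : (c : Colouring (suc n)) → c ≗ c zero ∷ tail c
∷-tail c zero    = refl
∷-tail c (suc i) = refl

map-not-∷ : ∀ b (c : Colouring n) → map not (b ∷ c) ≗ not b ∷ map not c
map-not-∷ b c zero    = refl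
map-not-∷ b c (suc i) = refl

∷-ext : ∀ {A : Set} {f : Colouring (suc n) → A} → Extensional f → ∀ b → Extensional (f ∘ (b ∷_))
∷-ext f-ext b c≗d = f-ext λ { zero → refl ; (suc i) → c≗d i }

_≐_ : Colouring n → Colouring n → Bool
_≐_ {zero}  c d = true
_≐_ {suc n} c d = (c zero ≡ᵇ d zero) ∧ (tail c ≐ tail d)

≐-sound : ∀ {c d : Colouring n} → T (c ≐ d) → c ≗ d
≐-sound {suc n} {c} c≐d zero    = ≡ᵇ-sound {c zero} (proj₁ (Equivalence.to T-∧ c≐d))
≐-sound {suc n}     c≐d (suc i) = ≐-sound (proj₂ (Equivalence.to T-∧ c≐d)) i

≐-complete : ∀ {c d : Colouring n} → c ≗ d → T (c ≐ d)
≐-complete {zero}  c≗d = _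
≐-complete {suc n} c≗d = Equivalence.from T-∧ (≡ᵇ-complete (c≗d zero) , ≐-complete (c≗d ∘ suc))

≐-cong : ∀ {c c′ d d′ : Colouring n} → c ≗ c′ → d ≗ d′ → (c ≐ d) ≡ (c′ ≐ d′)
≐-cong {zero}  c≗c′ d≗d′ = refl
≐-cong {suc n} c≗c′ d≗d′ =
  cong₂ _∧_ (cong₂ _≡ᵇ_ (c≗c′ zero) (d≗d′ zero)) (≐-cong (c≗c′ ∘ suc) (d≗d′ ∘ suc))

≐-not : ∀ (c d : Colouring n) → (map not c ≐ map not d) ≡ (c ≐ d)
≐-not {zero}  c d = refl
≐-not {suc n} c d = cong₂ _∧_ (not-≡ᵇ-not (c zero) (d zero)) (≐-not (tail c) (tail d))

record ComplementInvariant (P : Colouring n → Bool) : Set where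
  field
    ext           : Extensional P
    not-invariant : ∀ c → P (map not c) ≡ P c

∧-invariant : ∀ {P Q : Colouring n → Bool} → ComplementInvariant P → ComplementInvariant Q →
              ComplementInvariant (λ c → P c ∧ Q c)
∧-invariant P-inv Q-inv = record
  { ext           = λ c≗d → cong₂ _∧_ (P.ext c≗d) (Q.ext c≗d)
  ; not-invariant = λ c → cong₂ _∧_ (P.not-invariant c) (Q.not-invariant c)
  }
  where
  module P = ComplementInvariant P-inv
  module Q = ComplementInvariant Q-inv

agree-invariant : ∀ (i j : Fin n) → ComplementInvariant (λ c → c i ≡ᵇ c j)
agree-invariant i j = record
  { ext           = λ c≗d → cong₂ _≡ᵇ_ (c≗d i) (c≗d j)
  ; not-invariant = λ c → not-≡ᵇ-not (c i) (c j)
  }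

∑ : ∀ n → (Colouring n → ℕ) → ℕ
∑ zero    f = f []
∑ (suc n) f = ∑ n (f ∘ (true ∷_)) + ∑ n (f ∘ (false ∷_))

⟦_⟧ : Bool → ℕ
⟦ true  ⟧ = 1
⟦ false ⟧ = 0

count : ∀ n → (Colouring n → Bool) → ℕ
count n P = ∑ n (λ c → ⟦ P c ⟧)

⟦∧⟧ : ∀ a b → ⟦ a ∧ b ⟧ ≡ ⟦ a ⟧ * ⟦ b ⟧
⟦∧⟧ true  b = sym (+-identityʳ _)
⟦∧⟧ false b = refl

∑-cong : ∀ n {f g : Colouring n → ℕ} → (∀ c → f c ≡ g c) → ∑ n f ≡ ∑ n g
∑-cong zero    f≡g = f≡g []
∑-cong (suc n) f≡g = cong₂ _+_ (∑-cong n (f≡g ∘ (true ∷_))) (∑-cong n (f≡g ∘ (false ∷_)))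

count-cong : ∀ n {P Q : Colouring n → Bool} → (∀ c → P c ≡ Q c) → count n P ≡ count n Q
count-cong n P≡Q = ∑-cong n (cong ⟦_⟧ ∘ P≡Q)

∑-zero : ∀ n → ∑ n (λ _ → 0) ≡ 0
∑-zero zero    = refl
∑-zero (suc n) = cong₂ _+_ (∑-zero n) (∑-zero n)

count-true : ∀ n → count n (λ _ → true) ≡ 2 ^ n
count-true zero    = refl
count-true (suc n) =
  trans (cong₂ _+_ (count-true n) (count-true n)) (cong (2 ^ n +_) (sym (+-identityʳ _)))

∑-+ : ∀ n (f g : Colouring n → ℕ) → ∑ n (λ c → f c + g c) ≡ ∑ n f + ∑ n g
∑-+ zero    f g = refl
∑-+ (suc n) f g = begin
  ∑ n (λ c → f (true ∷ c) + g (true ∷ c)) + ∑ n (λ c → f (false ∷ c) + g (false ∷ c))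
    ≡⟨ cong₂ _+_ (∑-+ n (f ∘ (true ∷_)) (g ∘ (true ∷_))) (∑-+ n (f ∘ (false ∷_)) (g ∘ (false ∷_))) ⟩
  (∑ n (f ∘ (true ∷_)) + ∑ n (g ∘ (true ∷_))) + (∑ n (f ∘ (false ∷_)) + ∑ n (g ∘ (false ∷_)))
    ≡⟨ +-interchange (∑ n (f ∘ (true ∷_))) (∑ n (g ∘ (true ∷_))) (∑ n (f ∘ (false ∷_))) _ ⟩
  ∑ (suc n) f + ∑ (suc n) g ∎
  where open ≡-Reasoning

∑-*ˡ : ∀ n k (f : Colouring n → ℕ) → ∑ n (λ c → k * f c) ≡ k * ∑ n f
∑-*ˡ zero    k f = refl
∑-*ˡ (suc n) k f = trans (cong₂ _+_ (∑-*ˡ n k _) (∑-*ˡ n k _)) (sym (*-distribˡ-+ k _ _))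

∑-swap : ∀ n K (g : Colouring n → Colouring K → ℕ) →
         ∑ n (λ c → ∑ K (g c)) ≡ ∑ K (λ u → ∑ n (λ c → g c u))
∑-swap zero    K g = refl
∑-swap (suc n) K g = begin
  ∑ n (λ c → ∑ K (g (true ∷ c))) + ∑ n (λ c → ∑ K (g (false ∷ c)))
    ≡⟨ cong₂ _+_ (∑-swap n K _) (∑-swap n K _) ⟩
  ∑ K (λ u → ∑ n (λ c → g (true ∷ c) u)) + ∑ K (λ u → ∑ n (λ c → g (false ∷ c) u))
    ≡⟨ ∑-+ K _ _ ⟨
  ∑ K (λ u → ∑ (suc n) (λ c → g c u))  ∎
  where open ≡-Reasoning

∑-not : ∀ n {f : Colouring n → ℕ} → Extensional f → ∑ n (f ∘ map not) ≡ ∑ n f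
∑-not zero    f-ext = f-ext λ ()
∑-not (suc n) {f} f-ext = begin
  ∑ n (λ c → f (map not (true ∷ c))) + ∑ n (λ c → f (map not (false ∷ c)))
    ≡⟨ cong₂ _+_ (∑-cong n λ c → f-ext (map-not-∷ true c)) (∑-cong n λ c → f-ext (map-not-∷ false c)) ⟩
  ∑ n ((f ∘ (false ∷_)) ∘ map not) + ∑ n ((f ∘ (true ∷_)) ∘ map not)
    ≡⟨ cong₂ _+_ (∑-not n (∷-ext f-ext false)) (∑-not n (∷-ext f-ext true)) ⟩
  ∑ n (f ∘ (false ∷_)) + ∑ n (f ∘ (true ∷_))
    ≡⟨ +-comm (∑ n (f ∘ (false ∷_))) _ ⟩
  ∑ (suc n) f  ∎
  where open ≡-Reasoning

∑-point : ∀ n {f : Colouring n → ℕ} → Extensional f → ∀ d → ∑ n (λ c → ⟦ c ≐ d ⟧ * f c) ≡ f d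
∑-point zero    f-ext d = trans (+-identityʳ _) (f-ext λ ())
∑-point (suc n) {f} f-ext d = begin
  ∑ n (λ c → ⟦ (true ≡ᵇ d zero) ∧ (c ≐ tail d) ⟧ * f (true ∷ c))
    + ∑ n (λ c → ⟦ (false ≡ᵇ d zero) ∧ (c ≐ tail d) ⟧ * f (false ∷ c))
    ≡⟨ cong₂ _+_ (factor true) (factor false) ⟩
  ⟦ true ≡ᵇ d zero ⟧ * f (true ∷ tail d) + ⟦ false ≡ᵇ d zero ⟧ * f (false ∷ tail d)
    ≡⟨ select (d zero) ⟩
  f (d zero ∷ tail d)
    ≡⟨ f-ext (∷-tail d) ⟨
  f d ∎
  where
  open ≡-Reasoning
  factor : ∀ b → ∑ n (λ c → ⟦ (b ≡ᵇ d zero) ∧ (c ≐ tail d) ⟧ * f (b ∷ c))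
                 ≡ ⟦ b ≡ᵇ d zero ⟧ * f (b ∷ tail d)
  factor b = begin
    ∑ n (λ c → ⟦ (b ≡ᵇ d zero) ∧ (c ≐ tail d) ⟧ * f (b ∷ c))
      ≡⟨ ∑-cong n (λ c → trans (cong (_* f (b ∷ c)) (⟦∧⟧ (b ≡ᵇ d zero) _))
                              (*-assoc ⟦ b ≡ᵇ d zero ⟧ _ _)) ⟩
    ∑ n (λ c → ⟦ b ≡ᵇ d zero ⟧ * (⟦ c ≐ tail d ⟧ * f (b ∷ c)))
      ≡⟨ ∑-*ˡ n ⟦ b ≡ᵇ d zero ⟧ _ ⟩
    ⟦ b ≡ᵇ d zero ⟧ * ∑ n (λ c → ⟦ c ≐ tail d ⟧ * f (b ∷ c))
      ≡⟨ cong (⟦ b ≡ᵇ d zero ⟧ *_) (∑-point n (∷-ext f-ext b) (tail d)) ⟩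
    ⟦ b ≡ᵇ d zero ⟧ * f (b ∷ tail d) ∎
  select : ∀ x → ⟦ true ≡ᵇ x ⟧ * f (true ∷ tail d) + ⟦ false ≡ᵇ x ⟧ * f (false ∷ tail d) ≡ f (x ∷ tail d)
  select true  = trans (+-identityʳ _) (+-identityʳ _)
  select false = +-identityʳ _

count-split : ∀ n (P g : Colouring n → Bool) →
              count n P ≡ count n (λ c → P c ∧ g c) + count n (λ c → P c ∧ not (g c))
count-split n P g = trans (∑-cong n λ c → pointwise (P c) (g c)) (∑-+ n _ _)
  where
  pointwise : ∀ p g → ⟦ p ⟧ ≡ ⟦ p ∧ g ⟧ + ⟦ p ∧ not g ⟧
  pointwise true  true  = refl
  pointwise true  false = refl
  pointwise false g     = refl

count-complement : ∀ n {P : Colouring (suc n) → Bool} → ComplementInvariant P →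
                   count (suc n) P ≡ 2 * count n (P ∘ (true ∷_))
count-complement n {P} P-inv = begin
  half + count n (P ∘ (false ∷_))
    ≡⟨ cong (half +_) (∑-not n (cong ⟦_⟧ ∘ ∷-ext ext false)) ⟨
  half + count n (λ c → P (false ∷ map not c))
    ≡⟨ cong (half +_) (count-cong n λ c →
         trans (sym (ext (map-not-∷ true c))) (not-invariant (true ∷ c))) ⟩
  half + half
    ≡⟨ cong (half +_) (+-identityʳ half) ⟨
  2 * half ∎
  where
  open ≡-Reasoning
  open ComplementInvariant P-inv
  half = count n (P ∘ (true ∷_))

length-filter : ∀ {A : Set} {p} {P : Pred A p} (P? : Decidable P) xs →
                length (filter P? xs) ≡ sum (List.map (⟦_⟧ ∘ does ∘ P?) xs)
length-filter P? List.[]         = refl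
length-filter P? (x List.∷ xs) with does (P? x)
... | true  = cong suc (length-filter P? xs)
... | false = length-filter P? xs

sum-allColorings : ∀ n {f : Colouring n → ℕ} → Extensional f →
                   sum (List.map f (allColorings n)) ≡ ∑ n f
sum-allColorings zero    f-ext = trans (+-identityʳ _) (f-ext λ ())
sum-allColorings (suc n) {f} f-ext =
  halves _ _ (λ c → λ { zero → refl ; (suc i) → refl }) (λ c → λ { zero → refl ; (suc i) → refl })
  where
  cs = allColorings n
  half : ∀ (g : Colouring n → Colouring (suc n)) b → (∀ c → g c ≗ b ∷ c) →
         sum (List.map f (List.map g cs)) ≡ ∑ n (f ∘ (b ∷_))
  half g b g≗∷ = begin
    sum (List.map f (List.map g cs))  ≡⟨ cong sum (map-∘ cs) ⟨
    sum (List.map (f ∘ g) cs)         ≡⟨ cong sum (map-cong (f-ext ∘ g≗∷) cs) ⟩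
    sum (List.map (f ∘ (b ∷_)) cs)    ≡⟨ sum-allColorings n (∷-ext f-ext b) ⟩
    ∑ n (f ∘ (b ∷_))                  ∎
    where open ≡-Reasoning
  halves : ∀ g h → (∀ c → g c ≗ true ∷ c) → (∀ c → h c ≗ false ∷ c) →
           sum (List.map f (List.map g cs List.++ List.map h cs)) ≡ ∑ (suc n) f
  halves g h g≗∷ h≗∷ = begin
    sum (List.map f (List.map g cs List.++ List.map h cs))
      ≡⟨ cong sum (map-++ f (List.map g cs) _) ⟩
    sum (List.map f (List.map g cs) List.++ List.map f (List.map h cs))
      ≡⟨ sum-++ (List.map f (List.map g cs)) _ ⟩
    sum (List.map f (List.map g cs)) + sum (List.map f (List.map h cs))
      ≡⟨ cong₂ _+_ (half g true g≗∷) (half h false h≗∷) ⟩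
    ∑ (suc n) f ∎
    where open ≡-Reasoning

-- The colourings still possible after some queries: the balls fall into K classes, each with a
-- representative ball, and ball i has the colour of the representative of its class, flipped
-- when parity i holds.
record Chart (n K : ℕ) : Set where
  field
    class      : Fin n → Fin K
    parity     : Fin n → Bool
    rep        : Fin K → Fin n
    class-rep  : ∀ k → class (rep k) ≡ k
    parity-rep : ∀ k → parity (rep k) ≡ false

  expand : Colouring K → Colouring n
  expand u i = u (class i) xor parity i

  restrict : Colouring n → Colouring K
  restrict c = c ∘ rep

  consistent : Colouring n → Bool
  consistent c = c ≐ expand (restrict c)

open Chart

module _ (σ : Chart n K) where

  restrict-expand : ∀ u → restrict σ (expand σ u) ≗ u
  restrict-expand u k =
    trans (cong₂ (λ x p → u x xor p) (class-rep σ k) (parity-rep σ k)) (xor-identityʳ (u k))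

  expand-cong : ∀ {u v} → u ≗ v → expand σ u ≗ expand σ v
  expand-cong u≗v i = cong (_xor parity σ i) (u≗v (class σ i))

  expand-not : ∀ u → expand σ (map not u) ≗ map not (expand σ u)
  expand-not u i = sym (not-distribˡ-xor (u (class σ i)) (parity σ i))

  consistent-cong : Extensional (consistent σ)
  consistent-cong c≗d = ≐-cong c≗d (expand-cong (c≗d ∘ rep σ))

  consistent-not : ∀ c → consistent σ (map not c) ≡ consistent σ c
  consistent-not c = trans (≐-cong (λ _ → refl) (expand-not (restrict σ c))) (≐-not c _)

  consistent-expand : ∀ u → T (consistent σ (expand σ u))
  consistent-expand u = ≐-complete (sym ∘ expand-cong (restrict-expand u))

  ≐-expand : ∀ {c} → T (consistent σ c) → ∀ u → (c ≐ expand σ u) ≡ (u ≐ restrict σ c)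
  ≐-expand {c} c-cons u = T⇔T⇒≡
    (λ c≐eu → ≐-complete λ k → trans (sym (restrict-expand u k)) (sym (≐-sound c≐eu (rep σ k))))
    (λ u≐rc → ≐-complete λ i → trans (≐-sound c-cons i) (sym (expand-cong (≐-sound u≐rc) i)))

  ≐-expand-inconsistent : ∀ {c} → consistent σ c ≡ false → ∀ u → (c ≐ expand σ u) ≡ false
  ≐-expand-inconsistent {c} c-incons u = T⇔T⇒≡ {y = false}
    (λ c≐eu → subst T c-incons (subst T (sym (consistent-cong (≐-sound c≐eu))) (consistent-expand u)))
    λ ()

  ∑-fibre : ∀ c x → ∑ K (λ u → ⟦ c ≐ expand σ u ⟧ * x) ≡ ⟦ consistent σ c ⟧ * x
  ∑-fibre c x with consistent σ c in eq
  ... | true  = trans (∑-cong K λ u → cong (λ b → ⟦ b ⟧ * x) (≐-expand (subst T (sym eq) _) u))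
                      (trans (∑-point K (λ _ → refl) (restrict σ c)) (sym (+-identityʳ x)))
  ... | false = trans (∑-cong K λ u → cong (λ b → ⟦ b ⟧ * x) (≐-expand-inconsistent eq u)) (∑-zero K)

  ∑-consistent : ∀ {f : Colouring n → ℕ} → Extensional f →
                 ∑ n (λ c → ⟦ consistent σ c ⟧ * f c) ≡ ∑ K (f ∘ expand σ)
  ∑-consistent {f} f-ext = begin
    ∑ n (λ c → ⟦ consistent σ c ⟧ * f c)              ≡⟨ ∑-cong n (λ c → ∑-fibre c (f c)) ⟨
    ∑ n (λ c → ∑ K (λ u → ⟦ c ≐ expand σ u ⟧ * f c))  ≡⟨ ∑-swap n K _ ⟩
    ∑ K (λ u → ∑ n (λ c → ⟦ c ≐ expand σ u ⟧ * f c))  ≡⟨ ∑-cong K (λ u → ∑-point n f-ext (expand σ u)) ⟩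
    ∑ K (f ∘ expand σ)                                 ∎
    where open ≡-Reasoning

  count-consistent : ∀ {P} → Extensional P →
                     count n (λ c → consistent σ c ∧ P c) ≡ count K (P ∘ expand σ)
  count-consistent {P} P-ext =
    trans (∑-cong n λ c → ⟦∧⟧ (consistent σ c) (P c)) (∑-consistent (cong ⟦_⟧ ∘ P-ext))

  consistent-invariant : ComplementInvariant (consistent σ)
  consistent-invariant = record { ext = consistent-cong ; not-invariant = consistent-not }

  expand-invariant : ∀ {P} → ComplementInvariant P → ComplementInvariant (P ∘ expand σ)
  expand-invariant P-inv = record
    { ext           = ext ∘ expand-cong
    ; not-invariant = λ u → trans (ext (expand-not u)) (not-invariant (expand σ u))
    }
    where open ComplementInvariant P-inv

  rep-distinct : ∀ {k₁ k₂} → k₁ ≢ k₂ → class σ (rep σ k₁) ≢ class σ (rep σ k₂)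
  rep-distinct {k₁} {k₂} k₁≢k₂ same = k₁≢k₂ (trans (sym (class-rep σ k₁)) (trans same (class-rep σ k₂)))

  agree-same-class : ∀ {i j c} → class σ i ≡ class σ j → T (consistent σ c) →
                     (c i ≡ᵇ c j) ≡ (parity σ i ≡ᵇ parity σ j)
  agree-same-class {i} {j} {c} same c-cons = begin
    c i ≡ᵇ c j
      ≡⟨ cong₂ _≡ᵇ_ (≐-sound c-cons i) (≐-sound c-cons j) ⟩
    (v (class σ i) xor parity σ i) ≡ᵇ (v (class σ j) xor parity σ j)
      ≡⟨ cong (λ m → (v (class σ i) xor parity σ i) ≡ᵇ (v m xor parity σ j)) same ⟨
    (v (class σ i) xor parity σ i) ≡ᵇ (v (class σ i) xor parity σ j)
      ≡⟨ xor-≡ᵇ-xor (v (class σ i)) (parity σ i) (parity σ j) ⟩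
    parity σ i ≡ᵇ parity σ j ∎
    where
    open ≡-Reasoning
    v = restrict σ c

singletons : Chart n n
singletons = record
  { class = id ; parity = λ _ → false ; rep = id ; class-rep = λ _ → refl ; parity-rep = λ _ → refl }

consistent-singletons : ∀ c → T (consistent (singletons {n}) c)
consistent-singletons c = ≐-complete (sym ∘ xor-identityʳ ∘ c)

-- Adding the answer a to the query "do balls i and j (in different classes) agree?" merges the
-- class of i into that of j.
module Glue (σ : Chart n (suc K)) {i j : Fin n} (distinct : class σ i ≢ class σ j) (a : Bool) where

  private
    k  = class σ i
    k′ = punchOut distinct
    δ  = (parity σ j xor not a) xor parity σ i

    relabel : (m : Fin (suc K)) → Dec (m ≡ k) → Fin K × Bool
    relabel m (yes _)  = k′ , δ
    relabel m (no m≢k) = punchOut (m≢k ∘ sym) , false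

    relabel-punchIn : ∀ {l} m d → m ≡ punchIn k l → relabel m d ≡ (l , false)
    relabel-punchIn m (yes m≡k) m≡ = ⊥-elim (punchInᵢ≢i k _ (trans (sym m≡) m≡k))
    relabel-punchIn m (no m≢k)  m≡ = cong (_, false) (trans (punchOut-cong k m≡) (punchOut-punchIn k))

    relabel-insertAt : ∀ u m d →
                       u (proj₁ (relabel m d)) xor proj₂ (relabel m d) ≡ insertAt u k (u k′ xor δ) m
    relabel-insertAt u m (yes refl) = sym (insertAt-lookup u k _)
    relabel-insertAt u m (no m≢k)   = begin
      u (punchOut k≢m) xor false              ≡⟨ xor-identityʳ _ ⟩
      u (punchOut k≢m)                        ≡⟨ insertAt-punchIn u k _ _ ⟨
      insertAt u k _ (punchIn k (punchOut k≢m)) ≡⟨ cong (insertAt u k _) (punchIn-punchOut k≢m) ⟩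
      insertAt u k (u k′ xor δ) m             ∎
      where
      open ≡-Reasoning
      k≢m = m≢k ∘ sym

  glue : Chart n K
  glue = record
    { class      = λ m → proj₁ (relabel (class σ m) (class σ m ≟ k))
    ; parity     = λ m → proj₂ (relabel (class σ m) (class σ m ≟ k)) xor parity σ m
    ; rep        = rep σ ∘ punchIn k
    ; class-rep  = λ l → cong proj₁ (relabel-rep l)
    ; parity-rep = λ l → cong₂ (λ r p → proj₂ r xor p) (relabel-rep l) (parity-rep σ (punchIn k l))
    }
    where
    relabel-rep : ∀ l → let m = class σ (rep σ (punchIn k l)) in relabel m (m ≟ k) ≡ (l , false)
    relabel-rep l = relabel-punchIn _ (class σ (rep σ (punchIn k l)) ≟ k) (class-rep σ (punchIn k l))

  expand-glue : ∀ u → expand glue u ≗ expand σ (insertAt u k (u k′ xor δ))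
  expand-glue u m = trans (sym (xor-assoc (u (proj₁ r)) (proj₂ r) (parity σ m)))
                          (cong (_xor parity σ m) (relabel-insertAt u (class σ m) (class σ m ≟ k)))
    where r = relabel (class σ m) (class σ m ≟ k)

  consistent-glue : ∀ c → consistent glue c ≡ consistent σ c ∧ (a ≡ᵇ (c i ≡ᵇ c j))
  consistent-glue c = trans (≐-cong (λ _ → refl) (expand-glue u)) (T⇔T⇒≡ to from)
    where
    v = restrict σ c
    u = restrict glue c
    w = insertAt u k (u k′ xor δ)

    hyperplane : T (consistent σ c) → (a ≡ᵇ (c i ≡ᵇ c j)) ≡ (v k ≡ᵇ (u k′ xor δ))
    hyperplane c-cons = begin
      a ≡ᵇ (c i ≡ᵇ c j)
        ≡⟨ agree-shift a (c i) (c j) ⟩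
      c i ≡ᵇ (c j xor not a)
        ≡⟨ cong₂ (λ x y → x ≡ᵇ (y xor not a)) (≐-sound c-cons i) (≐-sound c-cons j) ⟩
      (v k xor βi) ≡ᵇ ((v kj xor βj) xor not a)
        ≡⟨ xor-shift (v k) βi _ ⟩
      v k ≡ᵇ (((v kj xor βj) xor not a) xor βi)
        ≡⟨ cong (v k ≡ᵇ_) (trans (cong (_xor βi) (xor-assoc (v kj) βj _)) (xor-assoc (v kj) _ βi)) ⟩
      v k ≡ᵇ (v kj xor δ)
        ≡⟨ cong (λ m → v k ≡ᵇ (v m xor δ)) (punchIn-punchOut distinct) ⟨
      v k ≡ᵇ (u k′ xor δ) ∎
      where
      open ≡-Reasoning
      βi = parity σ i
      βj = parity σ j
      kj = class σ j

    to : T (c ≐ expand σ w) → T (consistent σ c ∧ (a ≡ᵇ (c i ≡ᵇ c j)))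
    to c≐ew = Equivalence.from T-∧ (c-cons , subst T (sym (hyperplane c-cons)) (≡ᵇ-complete vk≡))
      where
      v≗w : v ≗ w
      v≗w l = trans (≐-sound c≐ew (rep σ l)) (restrict-expand σ w l)
      c-cons = ≐-complete λ m → trans (≐-sound c≐ew m) (sym (expand-cong σ v≗w m))
      vk≡ : v k ≡ u k′ xor δ
      vk≡ = trans (v≗w k) (insertAt-lookup u k _)

    from : T (consistent σ c ∧ (a ≡ᵇ (c i ≡ᵇ c j))) → T (c ≐ expand σ w)
    from h = ≐-complete λ m → trans (≐-sound c-cons m) (expand-cong σ v≗w m)
      where
      c-cons = proj₁ (Equivalence.to T-∧ h)
      vk≡ : v k ≡ u k′ xor δ
      vk≡ = ≡ᵇ-sound (subst T (hyperplane c-cons) (proj₂ (Equivalence.to T-∧ h)))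
      v≗w : v ≗ w
      v≗w l = trans (sym (insertAt-removeAt v k l)) (cong (λ x → insertAt u k x l) vk≡)

-- Weights and majorities

sumFin-cong : ∀ {f g : Fin n → ℚ} → (∀ i → f i ≡ g i) → sumFin f ≡ sumFin g
sumFin-cong {zero}  f≡g = refl
sumFin-cong {suc n} f≡g = cong₂ ℚ._+_ (f≡g zero) (sumFin-cong (f≡g ∘ suc))

sumFin-+ : ∀ (f g : Fin n → ℚ) → sumFin (λ i → f i ℚ.+ g i) ≡ sumFin f ℚ.+ sumFin g
sumFin-+ {zero}  f g = refl
sumFin-+ {suc n} f g = trans (cong (f zero ℚ.+ g zero ℚ.+_) (sumFin-+ (f ∘ suc) (g ∘ suc)))
                             (ℚ-interchange (f zero) (g zero) (sumFin (f ∘ suc)) (sumFin (g ∘ suc)))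
  where
  open CommutativeSemigroupProperties (CommutativeMonoid.commutativeSemigroup ℚₚ.+-0-commutativeMonoid)
    using () renaming (interchange to ℚ-interchange)

sumFin-mono : ∀ {f g : Fin n → ℚ} → (∀ i → f i ℚ.≤ g i) → sumFin f ℚ.≤ sumFin g
sumFin-mono {zero}  f≤g = ℚₚ.≤-refl
sumFin-mono {suc n} f≤g = ℚₚ.+-mono-≤ (f≤g zero) (sumFin-mono (f≤g ∘ suc))

half+half : ∀ x → x ℚ.* ½ ℚ.+ x ℚ.* ½ ≡ x
half+half x = trans (sym (ℚₚ.*-distribˡ-+ x ½ ½)) (ℚₚ.*-identityʳ x)

double*half : ∀ x → (x ℚ.+ x) ℚ.* ½ ≡ x
double*half x = trans (ℚₚ.*-distribʳ-+ ½ x x) (half+half x)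

module Majority (w : Fin n → ℚ) where

  balanced : Colouring n → Bool
  balanced c = does (classWeight w c true ℚₚ.≟ classWeight w c false)

  balanced-sound : ∀ c → T (balanced c) → classWeight w c true ≡ classWeight w c false
  balanced-sound c = does-sound (classWeight w c true ℚₚ.≟ classWeight w c false)

  balanced-complete : ∀ c → classWeight w c true ≡ classWeight w c false → T (balanced c)
  balanced-complete c = does-complete (classWeight w c true ℚₚ.≟ classWeight w c false)

  classWeight-cong : ∀ {c d} b → c ≗ d → classWeight w c b ≡ classWeight w d b
  classWeight-cong b c≗d = sumFin-cong λ i → cong (λ x → if x ≡ᵇ b then w i else 0ℚ) (c≗d i)

  classWeight-not : ∀ c b → classWeight w (map not c) b ≡ classWeight w c (not b)
  classWeight-not c b = sumFin-cong λ i → cong (if_then w i else 0ℚ) (not-≡ᵇ (c i) b)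

  total-split : ∀ c b → total w ≡ classWeight w c b ℚ.+ classWeight w c (not b)
  total-split c b = trans (sumFin-cong λ i → split (c i) b (w i))
                          (sumFin-+ (λ i → if c i ≡ᵇ b then w i else 0ℚ) _)
    where
    split : ∀ x b v → v ≡ (if x ≡ᵇ b then v else 0ℚ) ℚ.+ (if x ≡ᵇ not b then v else 0ℚ)
    split true  true  v = sym (ℚₚ.+-identityʳ v)
    split true  false v = sym (ℚₚ.+-identityˡ v)
    split false true  v = sym (ℚₚ.+-identityˡ v)
    split false false v = sym (ℚₚ.+-identityʳ v)

  balanced-cong : Extensional balanced
  balanced-cong c≗d =
    cong₂ (λ x y → does (x ℚₚ.≟ y)) (classWeight-cong true c≗d) (classWeight-cong false c≗d)

  balanced-not : ∀ c → balanced (map not c) ≡ balanced c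
  balanced-not c =
    trans (cong₂ (λ x y → does (x ℚₚ.≟ y)) (classWeight-not c true) (classWeight-not c false))
          (T⇔T⇒≡ (balanced-complete c ∘ sym ∘ does-sound swapped)
                 (does-complete swapped ∘ sym ∘ balanced-sound c))
    where swapped = classWeight w c false ℚₚ.≟ classWeight w c true

  balanced-invariant : ComplementInvariant balanced
  balanced-invariant = record { ext = balanced-cong ; not-invariant = balanced-not }

  balanced⇒¬majority : ∀ {c} → T (balanced c) → ∀ b → ¬ IsMajority w c b
  balanced⇒¬majority {c} bal b = ℚₚ.<-irrefl (begin
    total w ℚ.* ½              ≡⟨ cong (ℚ._* ½) (total-split c b) ⟩
    (W b ℚ.+ W (not b)) ℚ.* ½  ≡⟨ cong (λ x → (W b ℚ.+ x) ℚ.* ½) (equal b) ⟩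
    (W b ℚ.+ W b) ℚ.* ½        ≡⟨ double*half (W b) ⟩
    W b                        ∎)
    where
    open ≡-Reasoning
    W = classWeight w c
    equal : ∀ b → W (not b) ≡ W b
    equal true  = sym (balanced-sound c bal)
    equal false = balanced-sound c bal

  heavier⇒majority : ∀ {c b} → classWeight w c (not b) < classWeight w c b → IsMajority w c b
  heavier⇒majority {c} {b} lighter = begin-strict
    total w ℚ.* ½              ≡⟨ cong (ℚ._* ½) (total-split c b) ⟩
    (W b ℚ.+ W (not b)) ℚ.* ½  <⟨ ℚₚ.*-monoˡ-<-pos ½ (ℚₚ.+-monoʳ-< (W b) lighter) ⟩
    (W b ℚ.+ W b) ℚ.* ½        ≡⟨ double*half (W b) ⟩
    W b                        ∎
    where
    open ℚₚ.≤-Reasoning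
    W = classWeight w c

  ¬balanced⇒majority : ∀ {c} → ¬ T (balanced c) → ∃ (IsMajority w c)
  ¬balanced⇒majority {c} unbalanced with ℚₚ.<-cmp (classWeight w c true) (classWeight w c false)
  ... | tri< lt _ _ = false , heavier⇒majority {c} {false} lt
  ... | tri≈ _ eq _ = ⊥-elim (unbalanced (balanced-complete c eq))
  ... | tri> _ _ gt = true , heavier⇒majority {c} {true} gt

  majorities-meet : (∀ i → 0ℚ ℚ.≤ w i) → ∀ {c d b b′} → IsMajority w c b → IsMajority w d b′ →
                    ∃ λ k → c k ≡ b × d k ≡ b′
  majorities-meet nonneg {c} {d} {b} {b′} c-maj d-maj
    with any? (λ k → (c k Bool.≟ b) ×-dec (d k Bool.≟ b′))
  ... | yes common  = common
  ... | no disjoint = ⊥-elim (ℚₚ.<-irrefl (half+half (total w)) (begin-strict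
    total w ℚ.* ½ ℚ.+ total w ℚ.* ½                <⟨ ℚₚ.+-mono-< c-maj d-maj ⟩
    classWeight w c b ℚ.+ classWeight w d b′       ≤⟨ ℚₚ.+-mono-≤ (ℚₚ.≤-refl {classWeight w c b}) d⊆¬c ⟩
    classWeight w c b ℚ.+ classWeight w c (not b)  ≡⟨ total-split c b ⟨
    total w                                        ∎))
    where
    open ℚₚ.≤-Reasoning
    if-mono : ∀ p q v → (T p → T q) → 0ℚ ℚ.≤ v → (if p then v else 0ℚ) ℚ.≤ (if q then v else 0ℚ)
    if-mono true  true  v _   _   = ℚₚ.≤-refl
    if-mono true  false v p⇒q _   = ⊥-elim (p⇒q _)
    if-mono false true  v _   0≤v = 0≤v
    if-mono false false v _   _   = ℚₚ.≤-refl
    d⊆¬c : classWeight w d b′ ℚ.≤ classWeight w c (not b)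
    d⊆¬c = sumFin-mono λ k → if-mono _ _ (w k)
      (λ dk≡b′ → ≡ᵇ-complete (¬-not λ ck≡b → disjoint (k , ck≡b , ≡ᵇ-sound dk≡b′))) (nonneg k)

  correct⇒is-nothing≡balanced : ∀ {c} r → CorrectAnswer w c r → is-nothing r ≡ balanced c
  correct⇒is-nothing≡balanced {c} nothing no-majority with balanced c in eq
  ... | true  = refl
  ... | false = let b , majority = ¬balanced⇒majority {c} (subst T eq)
                in ⊥-elim (no-majority b majority)
  correct⇒is-nothing≡balanced {c} (just k) majority with balanced c in eq
  ... | true  = ⊥-elim (balanced⇒¬majority {c} (subst T (sym eq) _) (c k) majority)
  ... | false = refl

  majority-ball-cong : ∀ {c d} k → c ≗ d → IsMajority w d (d k) → IsMajority w c (c k)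
  majority-ball-cong {c} {d} k c≗d = subst (total w ℚ.* ½ <_)
    (trans (cong (classWeight w d) (sym (c≗d k))) (sym (classWeight-cong (c k) c≗d)))

  majority-ball-not : ∀ {c} k → IsMajority w c (c k) → IsMajority w (map not c) (not (c k))
  majority-ball-not {c} k = subst (total w ℚ.* ½ <_)
    (trans (cong (classWeight w c) (sym (not-involutive (c k)))) (sym (classWeight-not c (not (c k)))))

-- The lower bound

^-monoʳ-∣ : ∀ m {a b} → a ≤ b → m ^ a ∣ m ^ b
^-monoʳ-∣ m z≤n       = 1∣ _
^-monoʳ-∣ m (s≤s a≤b) = *-monoʳ-∣ m (^-monoʳ-∣ m a≤b)

count-∧-const : ∀ n (P Q : Colouring n → Bool) b →
                count n (λ c → (P c ∧ b) ∧ Q c) ≡ ⟦ b ⟧ * count n (λ c → P c ∧ Q c)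
count-∧-const n P Q b = trans (∑-cong n λ c → pointwise (P c) (Q c) b) (∑-*ˡ n ⟦ b ⟧ _)
  where
  pointwise : ∀ p q b → ⟦ (p ∧ b) ∧ q ⟧ ≡ ⟦ b ⟧ * ⟦ p ∧ q ⟧
  pointwise true  q b = ⟦∧⟧ b q
  pointwise false q b = sym (*-zeroʳ ⟦ b ⟧)

count-query : ∀ (P : Colouring n → Bool) i j (s d : Strategy n) →
              count n (λ c → P c ∧ is-nothing (run (query i j s d) c))
              ≡ count n (λ c → (P c ∧ (c i ≡ᵇ c j)) ∧ is-nothing (run s c))
                + count n (λ c → (P c ∧ not (c i ≡ᵇ c j)) ∧ is-nothing (run d c))
count-query {n} P i j s d =
  trans (∑-cong n λ c → pointwise (P c) (c i ≡ᵇ c j) (run s c) (run d c)) (∑-+ n _ _)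
  where
  pointwise : ∀ p g (u v : Maybe (Fin n)) →
              ⟦ p ∧ is-nothing (if g then u else v) ⟧
              ≡ ⟦ (p ∧ g) ∧ is-nothing u ⟧ + ⟦ (p ∧ not g) ∧ is-nothing v ⟧
  pointwise true  true  u v = sym (+-identityʳ _)
  pointwise true  false u v = refl
  pointwise false g     u v = refl

#undecided : Chart n K → Strategy n → ℕ
#undecided {n} σ t = count n (λ c → consistent σ c ∧ is-nothing (run t c))

-- A query between two classes splits the chart into two charts with one class fewer, and a query
-- inside a class has its answer fixed by the chart; so the colourings reaching the "no majority"
-- leaves come in blocks of 2^(K ∸ depth t).
2^∣#undecided : ∀ (t : Strategy n) (σ : Chart n K) → 2 ^ (K ∸ depth t) ∣ #undecided σ t
2^∣#undecided {K = K} noMajority σ =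
  ∣-reflexive (sym (trans (count-consistent σ (λ _ → refl)) (count-true K)))
2^∣#undecided {n} (majorityBall _) σ =
  subst (_ ∣_) (sym (trans (count-cong n λ c → ∧-zeroʳ (consistent σ c)) (∑-zero n))) (_ ∣0)
2^∣#undecided {K = zero} (query i j s d) σ with class σ i
... | ()
2^∣#undecided {n} {suc K} (query i j s d) σ with class σ i ≟ class σ j
... | yes same = subst (_ ∣_) (sym (count-query (consistent σ) i j s d))
                       (∣m∣n⇒∣m+n (decided id s (m≤m⊔n _ _)) (decided not d (m≤n⊔m _ _)))
  where
  decided : ∀ (f : Bool → Bool) t → depth t ≤ depth s ⊔ depth d →
            2 ^ (K ∸ (depth s ⊔ depth d))
              ∣ count n (λ c → (consistent σ c ∧ f (c i ≡ᵇ c j)) ∧ is-nothing (run t c))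
  decided f t t≤ = subst (_ ∣_) (sym count≡) (∣n⇒∣m*n ⟦ f b ⟧ (∣-trans 2^∣2^ (2^∣#undecided t σ)))
    where
    b = parity σ i ≡ᵇ parity σ j
    2^∣2^ = ^-monoʳ-∣ 2 (∸-monoʳ-≤ (suc K) (m≤n⇒m≤1+n t≤))
    count≡ : count n (λ c → (consistent σ c ∧ f (c i ≡ᵇ c j)) ∧ is-nothing (run t c))
             ≡ ⟦ f b ⟧ * #undecided σ t
    count≡ = trans (count-cong n λ c → cong (_∧ is-nothing (run t c))
                                 (∧-congˡ-T (consistent σ c) (cong f ∘ agree-same-class σ same)))
                   (count-∧-const n (consistent σ) _ _)
... | no distinct = subst (_ ∣_) (sym (count-query (consistent σ) i j s d))
                          (∣m∣n⇒∣m+n (split true s (m≤m⊔n _ _)) (split false d (m≤n⊔m _ _)))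
  where
  split : ∀ a t → depth t ≤ depth s ⊔ depth d →
          2 ^ (K ∸ (depth s ⊔ depth d))
            ∣ count n (λ c → (consistent σ c ∧ (a ≡ᵇ (c i ≡ᵇ c j))) ∧ is-nothing (run t c))
  split a t t≤ = subst (_ ∣_) (count-cong n λ c → cong (_∧ is-nothing (run t c)) (consistent-glue c))
                       (∣-trans (^-monoʳ-∣ 2 (∸-monoʳ-≤ K t≤)) (2^∣#undecided t glue))
    where open Glue σ distinct a

halve-∣ : ∀ k {m} → 2 ^ k ∣ m → 2 ^ (k ∸ 1) ∣ m / 2
halve-∣ zero    _           = 1∣ _
halve-∣ (suc k) {m} 2^k*2∣m = m*n∣o⇒m∣o/n (2 ^ k) 2 (subst (_∣ m) (*-comm 2 (2 ^ k)) 2^k*2∣m)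

∸-bound : ∀ n D l → n ∸ D ∸ 1 ≤ l → n ∸ 1 ∸ l ≤ D
∸-bound n D l n∸D∸1≤l = subst (_≤ D) (sym (∸-+-assoc n 1 l)) (m≤n+o⇒m∸n≤o n (suc l) (begin
  n                      ≤⟨ m≤n+m∸n n D ⟩
  D + (n ∸ D)            ≤⟨ +-monoʳ-≤ D (m≤n+m∸n (n ∸ D) 1) ⟩
  D + (1 + (n ∸ D ∸ 1))  ≤⟨ +-monoʳ-≤ D (s≤s n∸D∸1≤l) ⟩
  D + suc l              ≡⟨ +-comm D (suc l) ⟩
  suc l + D              ∎))
  where open ≤-Reasoning

module _ (w : Fin n → ℚ) where
  open Majority w

  orderedEqualSplits≡count : orderedEqualSplits w ≡ count n balanced
  orderedEqualSplits≡count =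
    trans (length-filter _ (allColorings n)) (sum-allColorings n (cong ⟦_⟧ ∘ balanced-cong))

  2^∣orderedEqualSplits : (t : Strategy n) → Solves w t → 2 ^ (n ∸ depth t) ∣ orderedEqualSplits w
  2^∣orderedEqualSplits t solves =
    subst (_ ∣_) (trans #undecided≡ (sym orderedEqualSplits≡count)) (2^∣#undecided t singletons)
    where
    #undecided≡ : #undecided singletons t ≡ count n balanced
    #undecided≡ = count-cong n λ c →
      trans (cong (_∧ is-nothing (run t c)) (Equivalence.to T-≡ (consistent-singletons c)))
            (correct⇒is-nothing≡balanced (run t c) (solves c))

lower-bound : ∀ n (w : Fin n → ℚ) l → IsMu (equalPartitions w) l →
              (t : Strategy n) → Solves w t → n ∸ 1 ∸ l ≤ depth t
lower-bound n w l (_ , maximal) t solves = ∸-bound n (depth t) l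
  (maximal (n ∸ depth t ∸ 1) (halve-∣ (n ∸ depth t) (2^∣orderedEqualSplits w t solves)))

equalPartitions≡half : ∀ {n} (w : Fin (suc n) → ℚ) →
                       equalPartitions w ≡ count n (Majority.balanced w ∘ (true ∷_))
equalPartitions≡half {n} w = trans (cong (_/ 2) (begin
  orderedEqualSplits w    ≡⟨ orderedEqualSplits≡count w ⟩
  count (suc n) balanced  ≡⟨ count-complement n balanced-invariant ⟩
  2 * half                ≡⟨ *-comm 2 half ⟩
  half * 2                ∎)) (m*n/n≡m half 2)
  where
  open Majority w
  open ≡-Reasoning
  half = count n (balanced ∘ (true ∷_))

-- The upper bound

¬2∣⇒%2≡1 : ∀ m → ¬ 2 ∣ m → m % 2 ≡ 1
¬2∣⇒%2≡1 m ¬2∣m with m % 2 | m%n<n m 2 | m%n≡0⇒n∣m m 2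
... | 0           | _            | 2∣m = ⊥-elim (¬2∣m (2∣m refl))
... | 1           | _            | _   = refl
... | suc (suc _) | s≤s (s≤s ()) | _

odd+odd : ∀ {a b} → ¬ 2 ∣ a → ¬ 2 ∣ b → 2 ∣ a + b
odd+odd {a} {b} ¬2∣a ¬2∣b = m%n≡0⇒n∣m (a + b) 2
  (trans (%-distribˡ-+ a b 2) (cong₂ (λ x y → (x + y) % 2) (¬2∣⇒%2≡1 a ¬2∣a) (¬2∣⇒%2≡1 b ¬2∣b)))

even-from-sum : ∀ {a b c N} e → a + b + c ≡ N + 2 * e → 2 ∣ N → ¬ 2 ∣ b → ¬ 2 ∣ c → 2 ∣ a
even-from-sum {a} {b} {c} e sum≡ 2∣N ¬2∣b ¬2∣c = ∣m+n∣m⇒∣n 2∣b+c+a (odd+odd ¬2∣b ¬2∣c)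
  where
  2∣b+c+a : 2 ∣ (b + c) + a
  2∣b+c+a = subst (2 ∣_) (sym (trans (trans (+-comm (b + c) a) (sym (+-assoc a b c))) sum≡))
                  (∣m∣n⇒∣m+n 2∣N (m∣m*n e))

2∤1 : ¬ 2 ∣ 1
2∤1 2∣1 with ∣1⇒≡1 2∣1
... | ()

-- Every colouring of three balls has either exactly one agreeing pair or three.
three-agreements : ∀ p x y z → ⟦ p ∧ (y ≡ᵇ z) ⟧ + ⟦ p ∧ (x ≡ᵇ y) ⟧ + ⟦ p ∧ (x ≡ᵇ z) ⟧
                               ≡ ⟦ p ⟧ + 2 * ⟦ (p ∧ (x ≡ᵇ y)) ∧ (x ≡ᵇ z) ⟧
three-agreements false x     y     z     = refl
three-agreements true  true  true  true  = refl
three-agreements true  true  true  false = refl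
three-agreements true  true  false true  = refl
three-agreements true  true  false false = refl
three-agreements true  false true  true  = refl
three-agreements true  false true  false = refl
three-agreements true  false false true  = refl
three-agreements true  false false false = refl

module _ (n : ℕ) (P x₀ x₁ x₂ : Colouring n → Bool) where

  #agree : (Colouring n → Bool) → (Colouring n → Bool) → ℕ
  #agree x y = count n (λ c → P c ∧ (x c ≡ᵇ y c))

  all-agree : Colouring n → Bool
  all-agree c = (P c ∧ (x₀ c ≡ᵇ x₁ c)) ∧ (x₀ c ≡ᵇ x₂ c)

  agreement-triangle : #agree x₁ x₂ + #agree x₀ x₁ + #agree x₀ x₂ ≡ count n P + 2 * count n all-agree
  agreement-triangle = begin
    ∑ n f₁₂ + ∑ n f₀₁ + ∑ n f₀₂
      ≡⟨ trans (∑-+ n (λ c → f₁₂ c + f₀₁ c) f₀₂) (cong (_+ ∑ n f₀₂) (∑-+ n f₁₂ f₀₁)) ⟨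
    ∑ n (λ c → f₁₂ c + f₀₁ c + f₀₂ c)
      ≡⟨ ∑-cong n (λ c → three-agreements (P c) (x₀ c) (x₁ c) (x₂ c)) ⟩
    ∑ n (λ c → ⟦ P c ⟧ + 2 * ⟦ all-agree c ⟧)
      ≡⟨ trans (∑-+ n _ _) (cong (count n P +_) (∑-*ˡ n 2 _)) ⟩
    count n P + 2 * count n all-agree ∎
    where
    open ≡-Reasoning
    f₁₂ = λ c → ⟦ P c ∧ (x₁ c ≡ᵇ x₂ c) ⟧
    f₀₁ = λ c → ⟦ P c ∧ (x₀ c ≡ᵇ x₁ c) ⟧
    f₀₂ = λ c → ⟦ P c ∧ (x₀ c ≡ᵇ x₂ c) ⟧

  agreement-parity : 2 ∣ count n P → ¬ 2 ∣ #agree x₀ x₁ → ¬ 2 ∣ #agree x₀ x₂ → 2 ∣ #agree x₁ x₂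
  agreement-parity = even-from-sum (count n all-agree) agreement-triangle

4∣⇒2∣half : ∀ {P : Colouring (suc n) → Bool} → ComplementInvariant P →
            4 ∣ count (suc n) P → 2 ∣ count n (P ∘ (true ∷_))
4∣⇒2∣half {n} P-inv 4∣ = *-cancelˡ-∣ {m = 2} 2 (subst (4 ∣_) (count-complement n P-inv) 4∣)

2∣half⇒4∣ : ∀ {P : Colouring (suc n) → Bool} → ComplementInvariant P →
            2 ∣ count n (P ∘ (true ∷_)) → 4 ∣ count (suc n) P
2∣half⇒4∣ {n} P-inv 2∣ = subst (4 ∣_) (sym (count-complement n P-inv)) (*-monoʳ-∣ 2 2∣)

2∣⟦⟧+⟦⟧ : ∀ x y → 2 ∣ ⟦ x ⟧ + ⟦ y ⟧ → x ≡ y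
2∣⟦⟧+⟦⟧ true  true  _   = refl
2∣⟦⟧+⟦⟧ true  false 2∣1 = ⊥-elim (2∤1 2∣1)
2∣⟦⟧+⟦⟧ false true  2∣1 = ⊥-elim (2∤1 2∣1)
2∣⟦⟧+⟦⟧ false false _   = refl

∀-Colouring₂ : ∀ {Q : Colouring 2 → Set} → (∀ {u v} → u ≗ v → Q u → Q v) →
               (∀ u → Q u → Q (map not u)) → Q (true ∷ true ∷ []) → Q (true ∷ false ∷ []) → ∀ u → Q u
∀-Colouring₂ {Q} Q-cong Q-not Qtt Qtf u =
  Q-cong (λ { zero → refl ; (suc zero) → refl }) (cases (u zero) (u (suc zero)))
  where
  cases : ∀ x y → Q (x ∷ y ∷ [])
  cases true  true  = Qtt
  cases true  false = Qtf
  cases false true  = Q-cong (λ { zero → refl ; (suc zero) → refl }) (Q-not _ Qtf)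
  cases false false = Q-cong (λ { zero → refl ; (suc zero) → refl }) (Q-not _ Qtt)

module Construction (w : Fin (suc n) → ℚ) (nonneg : ∀ i → 0ℚ ℚ.≤ w i) where
  open Majority w

  #balanced : Chart (suc n) K → ℕ
  #balanced σ = count (suc n) (λ c → consistent σ c ∧ balanced c)

  #agreeing : Chart (suc n) K → Fin (suc n) → Fin (suc n) → ℕ
  #agreeing σ i j = count (suc n) (λ c → (consistent σ c ∧ balanced c) ∧ (c i ≡ᵇ c j))

  -- All these counts are complement-invariant, hence twice the counts over the colourings giving
  -- ball 0 colour true; on those halves divisibility by 4 becomes parity.
  third-pair-4∣ : ∀ (σ : Chart (suc n) K) r₀ r₁ r₂ → 4 ∣ #balanced σ →
                  ¬ 4 ∣ #agreeing σ r₀ r₁ → ¬ 4 ∣ #agreeing σ r₀ r₂ → 4 ∣ #agreeing σ r₁ r₂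
  third-pair-4∣ σ r₀ r₁ r₂ 4∣N ¬4∣A₀₁ ¬4∣A₀₂ = 2∣half⇒4∣ (agreeing-invariant r₁ r₂)
    (agreement-parity n (B ∘ (true ∷_)) (bit r₀) (bit r₁) (bit r₂)
                      (4∣⇒2∣half B-invariant 4∣N)
                      (¬4∣A₀₁ ∘ 2∣half⇒4∣ (agreeing-invariant r₀ r₁))
                      (¬4∣A₀₂ ∘ 2∣half⇒4∣ (agreeing-invariant r₀ r₂)))
    where
    B = λ c → consistent σ c ∧ balanced c
    B-invariant = ∧-invariant (consistent-invariant σ) balanced-invariant
    agreeing-invariant = λ i j → ∧-invariant B-invariant (agree-invariant i j)
    bit : Fin (suc n) → Colouring n → Bool
    bit r c = (true ∷ c) r

  4∣#balanced-glue : ∀ (σ : Chart (suc n) (suc K)) {i j} (distinct : class σ i ≢ class σ j) →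
                     4 ∣ #balanced σ → 4 ∣ #agreeing σ i j → ∀ a → 4 ∣ #balanced (Glue.glue σ distinct a)
  4∣#balanced-glue σ {i} {j} distinct 4∣N 4∣A a = subst (4 ∣_) (sym (glued a)) (4∣ a)
    where
    B = λ c → consistent σ c ∧ balanced c
    glued : ∀ a → #balanced (Glue.glue σ distinct a) ≡ count (suc n) (λ c → B c ∧ (a ≡ᵇ (c i ≡ᵇ c j)))
    glued a = count-cong (suc n) λ c → trans (cong (_∧ balanced c) (Glue.consistent-glue σ distinct a c))
                                             (∧-swapʳ (consistent σ c) _ (balanced c))
    4∣ : ∀ a → 4 ∣ count (suc n) (λ c → B c ∧ (a ≡ᵇ (c i ≡ᵇ c j)))
    4∣ true  = 4∣A
    4∣ false = ∣m+n∣m⇒∣n (subst (4 ∣_) (count-split (suc n) B (λ c → c i ≡ᵇ c j)) 4∣N) 4∣A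

  module Leaf (σ : Chart (suc n) 2) where

    c₀ c₁ : Colouring (suc n)
    c₀ = expand σ (true ∷ true ∷ [])
    c₁ = expand σ (true ∷ false ∷ [])

    CommonMajority : Fin (suc n) → Set
    CommonMajority k = IsMajority w c₀ (c₀ k) × IsMajority w c₁ (c₁ k)

    common-majority? : Decidable CommonMajority
    common-majority? k = (_ <? _) ×-dec (_ <? _)

    answer : Bool → Dec (∃ CommonMajority) → Strategy (suc n)
    answer true  _             = noMajority
    answer false (yes (k , _)) = majorityBall k
    answer false (no _)        = noMajority

    leaf : Strategy (suc n)
    leaf = answer (balanced c₀) (any? common-majority?)

    leaf-depth : depth leaf ≤ 0
    leaf-depth = answer-depth (balanced c₀) _
      where
      answer-depth : ∀ b d → depth (answer b d) ≤ 0
      answer-depth true  _       = z≤n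
      answer-depth false (yes _) = z≤n
      answer-depth false (no _)  = z≤n

    module _ (4∣N : 4 ∣ #balanced σ) where

      -- The four colourings of the chart form two complementary pairs, so 4 ∣ #balanced σ forces
      -- c₀ and c₁ to be both balanced or both unbalanced.
      balanced-c₀≡c₁ : balanced c₀ ≡ balanced c₁
      balanced-c₀≡c₁ = 2∣⟦⟧+⟦⟧ _ _ (4∣⇒2∣half (expand-invariant σ balanced-invariant)
                                              (subst (4 ∣_) (count-consistent σ balanced-cong) 4∣N))

      balanced-uniform : ∀ u → balanced (expand σ u) ≡ balanced c₀
      balanced-uniform = ∀-Colouring₂ {Q = λ u → balanced (expand σ u) ≡ balanced c₀}
        (λ {u} {v} u≗v → trans (balanced-cong (expand-cong σ {v} {u} (sym ∘ u≗v))))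
        (λ u → trans (ComplementInvariant.not-invariant (expand-invariant σ balanced-invariant) u))
        refl (sym balanced-c₀≡c₁)

      majority-uniform : ∀ {k} → CommonMajority k → ∀ u → IsMajority w (expand σ u) (expand σ u k)
      majority-uniform {k} (m₀ , m₁) = ∀-Colouring₂ {Q = λ u → IsMajority w (expand σ u) (expand σ u k)}
        (λ {u} {v} u≗v → majority-ball-cong {expand σ v} {expand σ u} k (expand-cong σ (sym ∘ u≗v)))
        (λ u → majority-ball-cong {expand σ (map not u)} k (expand-not σ u)
               ∘ majority-ball-not {expand σ u} k)
        m₀ m₁

      common-majority : balanced c₀ ≡ false → ∃ CommonMajority
      common-majority c₀-unbalanced =
        let b₀ , m₀ = ¬balanced⇒majority {c₀} (subst T c₀-unbalanced)
            b₁ , m₁ = ¬balanced⇒majority {c₁} (subst T (trans (sym balanced-c₀≡c₁) c₀-unbalanced))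
            k , c₀k≡b₀ , c₁k≡b₁ = majorities-meet nonneg {c₀} {c₁} m₀ m₁
        in k , subst (IsMajority w c₀) (sym c₀k≡b₀) m₀ , subst (IsMajority w c₁) (sym c₁k≡b₁) m₁

      leaf-correct : ∀ c → T (consistent σ c) → CorrectAnswer w c (run leaf c)
      leaf-correct c c-cons = correct (balanced c₀) refl (any? common-majority?)
        where
        u = restrict σ c
        c≗ = ≐-sound c-cons
        correct : ∀ b → balanced c₀ ≡ b → (d : Dec (∃ CommonMajority)) →
                  CorrectAnswer w c (run (answer b d) c)
        correct true c₀-balanced _ = balanced⇒¬majority {c} (subst T (sym c-balanced) _)
          where
          c-balanced = trans (balanced-cong {c} {expand σ u} c≗) (trans (balanced-uniform u) c₀-balanced)
        correct false _ (yes (k , common)) =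
          majority-ball-cong {c} {expand σ u} k c≗ (majority-uniform common u)
        correct false c₀-unbalanced (no none) = ⊥-elim (none (common-majority c₀-unbalanced))

  open Leaf using (leaf; leaf-depth; leaf-correct)

  ask : (σ : Chart (suc n) (suc K)) {k₁ k₂ : Fin (suc K)} → k₁ ≢ k₂ →
        (Chart (suc n) K → Strategy (suc n)) → Strategy (suc n)
  ask σ {k₁} {k₂} k₁≢k₂ next =
    query (rep σ k₁) (rep σ k₂) (next (Glue.glue σ distinct true)) (next (Glue.glue σ distinct false))
    where distinct = rep-distinct σ k₁≢k₂

  ask-depth : ∀ (σ : Chart (suc n) (suc K)) {k₁ k₂} (k₁≢k₂ : k₁ ≢ k₂) next {d} →
              (∀ σ′ → depth (next σ′) ≤ d) → depth (ask σ k₁≢k₂ next) ≤ suc d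
  ask-depth σ k₁≢k₂ next next≤ = s≤s (⊔-lub (next≤ _) (next≤ _))

  ask-correct : ∀ (σ : Chart (suc n) (suc K)) {k₁ k₂} (k₁≢k₂ : k₁ ≢ k₂) next →
                (∀ σ′ → 4 ∣ #balanced σ′ → ∀ c → T (consistent σ′ c) →
                        CorrectAnswer w c (run (next σ′) c)) →
                4 ∣ #balanced σ → 4 ∣ #agreeing σ (rep σ k₁) (rep σ k₂) →
                ∀ c → T (consistent σ c) → CorrectAnswer w c (run (ask σ k₁≢k₂ next) c)
  ask-correct σ {k₁} {k₂} k₁≢k₂ next next-correct 4∣N 4∣A c c-cons = decide _ refl
    where
    distinct = rep-distinct σ k₁≢k₂
    branch : ∀ a → (c (rep σ k₁) ≡ᵇ c (rep σ k₂)) ≡ a →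
             CorrectAnswer w c (run (next (Glue.glue σ distinct a)) c)
    branch a agree = next-correct _ (4∣#balanced-glue σ distinct 4∣N 4∣A a) c
      (subst T (sym (Glue.consistent-glue σ distinct a c))
               (Equivalence.from T-∧ (c-cons , ≡ᵇ-complete (sym agree))))
    decide : ∀ g → (c (rep σ k₁) ≡ᵇ c (rep σ k₂)) ≡ g →
             CorrectAnswer w c (if g then run (next (Glue.glue σ distinct true)) c
                                     else run (next (Glue.glue σ distinct false)) c)
    decide true  = branch true
    decide false = branch false

  -- Named rather than written as λ (), so that strategy and the lemmas about it share these proofs
  -- (they end up inside the glued charts).
  private
    0≢1 : ∀ {k} → _≢_ {A = Fin (3 + k)} zero (suc zero)
    0≢1 ()
    0≢2 : ∀ {k} → _≢_ {A = Fin (3 + k)} zero (suc (suc zero))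
    0≢2 ()
    1≢2 : ∀ {k} → _≢_ {A = Fin (3 + k)} (suc zero) (suc (suc zero))
    1≢2 ()

  #agreeing₀₁ #agreeing₀₂ : Chart (suc n) (3 + K) → ℕ
  #agreeing₀₁ σ = #agreeing σ (rep σ zero) (rep σ (suc zero))
  #agreeing₀₂ σ = #agreeing σ (rep σ zero) (rep σ (suc (suc zero)))

  strategy : ∀ k → Chart (suc n) (2 + k) → Strategy (suc n)
  strategy zero    σ = leaf σ
  strategy (suc k) σ with 4 ∣? #agreeing₀₁ σ | 4 ∣? #agreeing₀₂ σ
  ... | yes _ | _     = ask σ 0≢1 (strategy k)
  ... | no _  | yes _ = ask σ 0≢2 (strategy k)
  ... | no _  | no _  = ask σ 1≢2 (strategy k)

  strategy-depth : ∀ k σ → depth (strategy k σ) ≤ k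
  strategy-depth zero    σ = leaf-depth σ
  strategy-depth (suc k) σ with 4 ∣? #agreeing₀₁ σ | 4 ∣? #agreeing₀₂ σ
  ... | yes _ | _     = ask-depth σ 0≢1 (strategy k) (strategy-depth k)
  ... | no _  | yes _ = ask-depth σ 0≢2 (strategy k) (strategy-depth k)
  ... | no _  | no _  = ask-depth σ 1≢2 (strategy k) (strategy-depth k)

  strategy-correct : ∀ k σ → 4 ∣ #balanced σ → ∀ c → T (consistent σ c) →
                     CorrectAnswer w c (run (strategy k σ) c)
  strategy-correct zero    σ = leaf-correct σ
  strategy-correct (suc k) σ 4∣N with 4 ∣? #agreeing₀₁ σ | 4 ∣? #agreeing₀₂ σ
  ... | yes 4∣A₀₁ | _          = ask-correct σ 0≢1 (strategy k) (strategy-correct k) 4∣N 4∣A₀₁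
  ... | no _      | yes 4∣A₀₂ = ask-correct σ 0≢2 (strategy k) (strategy-correct k) 4∣N 4∣A₀₂
  ... | no ¬4∣A₀₁ | no ¬4∣A₀₂ = ask-correct σ 1≢2 (strategy k) (strategy-correct k) 4∣N
    (third-pair-4∣ σ (rep σ zero) (rep σ (suc zero)) (rep σ (suc (suc zero))) 4∣N ¬4∣A₀₁ ¬4∣A₀₂)

upper-bound : ∀ n (w : Fin n → ℚ) → (∀ i → 0ℚ < w i) → equalPartitions w ≢ 0 →
              equalPartitions w % 2 ≡ 0 → ∃[ t ] (Solves w t × depth t ≤ n ∸ 2)
upper-bound zero w _ p≢0 _ = ⊥-elim (p≢0 refl)
upper-bound (suc zero) w _ p≢0 p-even = ⊥-elim
  (bit-not-even (subst (_≢ 0) (equalPartitions≡half w) p≢0) (subst (2 ∣_) (equalPartitions≡half w) 2∣p))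
  where
  2∣p = m%n≡0⇒n∣m _ 2 p-even
  bit-not-even : ∀ {b} → ⟦ b ⟧ ≢ 0 → 2 ∣ ⟦ b ⟧ → ⊥
  bit-not-even {true}  _   2∣1 = 2∤1 2∣1
  bit-not-even {false} 0≢0 _   = 0≢0 refl
upper-bound (suc (suc m)) w positive p≢0 p-even =
  strategy m singletons , (λ c → strategy-correct m singletons 4∣N c (consistent-singletons c))
                        , strategy-depth m singletons
  where
  open Construction w (ℚₚ.<⇒≤ ∘ positive)
  open Majority w
  #balanced≡ : #balanced singletons ≡ count (2 + m) balanced
  #balanced≡ = count-cong _ λ c → cong (_∧ balanced c) (Equivalence.to T-≡ (consistent-singletons c))
  4∣N : 4 ∣ #balanced singletons
  4∣N = subst (4 ∣_) (sym #balanced≡)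
              (2∣half⇒4∣ balanced-invariant (subst (2 ∣_) (equalPartitions≡half w) 2∣p))
    where 2∣p = m%n≡0⇒n∣m _ 2 p-even

proposition3 : (n : ℕ) (w : Fin n → ℚ) → (∀ i → 0ℚ < w i) →
    equalPartitions w ≢ 0 →
      ((l : ℕ) → IsMu (equalPartitions w) l →
         (t : Strategy n) → Solves w t → n ∸ 1 ∸ l ≤ depth t)
    × (equalPartitions w % 2 ≡ 0 →
         ∃[ t ] (Solves w t × depth t ≤ n ∸ 2))
proposition3 n w positive p≢0 = lower-bound n w , upper-bound n w positive p≢0
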